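{- Let $F$ be a field, $b,c\in F$, and let $f(x)=x^2+bx+c\in F[x]$ be irreducible with a root $\alpha\in F(\sqrt{\Delta})\setminus F$, where $\Delta=b^2-4c$. Let $m$ be a positive integer. Then $\alpha\in F(\sqrt{\Delta})^m$ (i.e. $\alpha=\gamma^m$ for some $\gamma\in F(\sqrt{\Delta})$) if and only if there exist $n,t\in F$ with $c=n^m$ and $b=-D_m(t,n)$.
   Context: The Dickson polynomials of the first kind are defined by $D_1(t,n)=t$, $D_2(t,n)=t^2-2n$, $D_k(t,n)=tD_{k-1}(t,n)-nD_{k-2}(t,n)$ for $k>2$. -}

module Defs where

open import Level using (Level; _⊔_; suc)
open import Data.Nat using (ℕ; zero) renaming (suc to 1+)
open import Data.Product using (Σ; ∃; _×_; _,_)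
open import Relation.Nullary using (¬_)
open import Algebra.Bundles using (CommutativeRing)

record Field (c ℓ : Level) : Set (Level.suc (c ⊔ ℓ)) where
  field
    commutativeRing : CommutativeRing c ℓ
  open CommutativeRing commutativeRing public
  field
    0≉1     : ¬ (0# ≈ 1#)
    inverse : ∀ x → ¬ (x ≈ 0#) → Σ Carrier λ y → (x * y) ≈ 1#

module _ {c ℓ : Level} (F : Field c ℓ) where
  open Field F

  pow : Carrier → ℕ → Carrier
  pow x zero = 1#
  pow x (1+ k) = x * pow x k

  -- Dickson polynomials of the first kind D_k(t,n):
  -- D_0 = 2 (only used to make the recurrence uniform), D_1 = t,
  -- D_2 = t^2 - 2n, D_k = t D_{k-1} - n D_{k-2}.
  dickson : ℕ → Carrier → Carrier → Carrier
  dickson zero t n = 1# + 1#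
  dickson (1+ zero) t n = t
  dickson (1+ (1+ zero)) t n = (t * t) - ((1# + 1#) * n)
  dickson (1+ (1+ (1+ k))) t n =
    (t * dickson (1+ (1+ k)) t n) - (n * dickson (1+ k) t n)

  -- The monic quadratic x^2 + b x + c is irreducible in F[x]:
  -- it admits no factorisation (x + p)(x + q) into monic linear factors
  -- (every factorisation of a monic quadratic over a field into
  -- non-units is, after normalising by units, of this form).
  IrreducibleQuad : Carrier → Carrier → Set (c ⊔ ℓ)
  IrreducibleQuad b c' = ¬ (Σ Carrier λ p → Σ Carrier λ q → ((p + q) ≈ b) × ((p * q) ≈ c'))

  -- The quadratic extension F(√Δ), modelled as F[s]/(s^2 - Δ):
  -- the pair (u , v) stands for u + v √Δ.
  module Ext (Δ : Carrier) where
    E : Set c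
    E = Carrier × Carrier

    _≈E_ : E → E → Set ℓ
    (u , v) ≈E (u' , v') = (u ≈ u') × (v ≈ v')

    embed : Carrier → E
    embed u = (u , 0#)

    _+E_ : E → E → E
    (u , v) +E (u' , v') = (u + u' , v + v')

    _*E_ : E → E → E
    (u , v) *E (u' , v') = ((u * u') + (Δ * (v * v')) , (u * v') + (v * u'))

    powE : E → ℕ → E
    powE x zero = embed 1#
    powE x (1+ k) = x *E powE x k

    InF : E → Set ℓ
    InF (u , v) = v ≈ 0#

-- Write α = u + v√Δ and, for γ ∈ F(√Δ), T(γ) = 2 Re γ and N(γ) = (Re γ)² - Δ (Im γ)².
-- Comparing coordinates in α² + bα + c = 0 gives T(α) = -b and N(α) = c; irreducibility
-- gives Δ ≠ 0 and 2 ≠ 0, and then Δ = T(α)² - 4N(α) = 4Δv² forces 4v² = 1.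
-- By Cayley–Hamilton, γ² = T(γ)γ - N(γ), so both coordinates of γᵏ satisfy the Dickson
-- recurrence x(k+2) = T x(k+1) - N x(k): T(γᵏ) = D_k(T, N) and Im γᵏ⁺¹ = Im γ · E_k(T, N),
-- while N(γᵏ) = Nᵏ. If α = γᵐ this yields n = N(γ), t = T(γ).
-- Conversely, applying the same facts to t/2 + √(t² - 4n)/2 gives
-- D_m(t,n)² - 4nᵐ = (t² - 4n) E_{m-1}(t,n)², i.e. Δ = (t² - 4n) e² with e ≠ 0. Then
-- γ = t/2 + (v/e)√Δ has trace t and norm n, so γᵐ has the same trace and the same
-- √Δ-coordinate as α, hence γᵐ = α.
module Submission where

open import Level using (Level; _⊔_)
open import Data.Maybe using (Maybe; just; nothing)
open import Data.Nat as ℕ using (ℕ; zero; suc; _≤_)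
import Data.Nat.Properties as ℕ
open import Data.Integer as ℤ using (ℤ; +_; -[1+_]; +0; +[1+_]; _◃_; sign; ∣_∣)
import Data.Integer.Properties as ℤ
open import Data.Sign as Sign using (Sign)
open import Data.Product using (Σ; _,_; _×_; proj₁; proj₂)
open import Function.Bundles using (_⇔_; mk⇔)
open import Relation.Nullary using (¬_; yes; no)
open import Relation.Binary.PropositionalEquality as ≡ using (_≡_)
open import Algebra.Bundles using (CommutativeRing)
import Algebra.Solver.Ring.AlmostCommutativeRing as ACR
open import Defs

-- Algebra.Solver.Ring needs a coefficient ring with a homomorphism into the
-- carrier; for an arbitrary commutative ring this is ℤ.
module IntegerCoefficientSolver {a ℓ} (R : CommutativeRing a ℓ) where
  open CommutativeRing R hiding (zero)
  open import Algebra.Properties.Semiring.Mult.TCOptimised semiring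
    using (×-homo-+; ×1-homo-*) renaming (_×_ to _·_)
  open import Algebra.Properties.Ring ring
    using (-‿involutive; -0#≈0#; -‿distribˡ-*; -‿distribʳ-*; -‿+-comm)
  open import Relation.Binary.Reasoning.Setoid setoid

  ⟦_⟧ℤ : ℤ → Carrier
  ⟦ + n ⟧ℤ = n · 1#
  ⟦ -[1+ n ] ⟧ℤ = - (suc n · 1#)

  [x+y]-[x+z]≈y-z : ∀ x y z → (x + y) - (x + z) ≈ y - z
  [x+y]-[x+z]≈y-z x y z = begin
    (x + y) - (x + z)      ≈⟨ +-congˡ (sym (-‿+-comm x z)) ⟩
    (x + y) + (- x - z)    ≈⟨ +-congʳ (+-comm x y) ⟩
    (y + x) + (- x - z)    ≈⟨ +-assoc y x _ ⟩
    y + (x + (- x - z))    ≈⟨ +-congˡ (sym (+-assoc x (- x) (- z))) ⟩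
    y + ((x - x) - z)      ≈⟨ +-congˡ (+-congʳ (-‿inverseʳ x)) ⟩
    y + (0# - z)           ≈⟨ +-congˡ (+-identityˡ (- z)) ⟩
    y - z                  ∎

  ⊖-homo : ∀ m n → ⟦ m ℤ.⊖ n ⟧ℤ ≈ m · 1# - n · 1#
  ⊖-homo zero    zero    = sym (trans (+-identityˡ _) -0#≈0#)
  ⊖-homo zero    (suc n) = sym (+-identityˡ _)
  ⊖-homo (suc m) zero    = sym (trans (+-congˡ -0#≈0#) (+-identityʳ _))
  ⊖-homo (suc m) (suc n) = begin
    ⟦ suc m ℤ.⊖ suc n ⟧ℤ            ≡⟨ ≡.cong ⟦_⟧ℤ (ℤ.[1+m]⊖[1+n]≡m⊖n m n) ⟩
    ⟦ m ℤ.⊖ n ⟧ℤ                    ≈⟨ ⊖-homo m n ⟩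
    m · 1# - n · 1#                 ≈⟨ [x+y]-[x+z]≈y-z 1# (m · 1#) (n · 1#) ⟨
    (1# + m · 1#) - (1# + n · 1#)   ≈⟨ +-cong (×-homo-+ 1# 1 m) (-‿cong (×-homo-+ 1# 1 n)) ⟨
    suc m · 1# - suc n · 1#         ∎

  +-homo : ∀ i j → ⟦ i ℤ.+ j ⟧ℤ ≈ ⟦ i ⟧ℤ + ⟦ j ⟧ℤ
  +-homo (+ m)    (+ n)    = ×-homo-+ 1# m n
  +-homo (+ m)    -[1+ n ] = ⊖-homo m (suc n)
  +-homo -[1+ m ] (+ n)    = trans (⊖-homo n (suc m)) (+-comm _ _)
  +-homo -[1+ m ] -[1+ n ] = begin
    - (suc (suc (m ℕ.+ n)) · 1#)    ≡⟨ ≡.cong (λ k → - (suc k · 1#)) (ℕ.+-suc m n) ⟨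
    - ((suc m ℕ.+ suc n) · 1#)      ≈⟨ -‿cong (×-homo-+ 1# (suc m) (suc n)) ⟩
    - (suc m · 1# + suc n · 1#)     ≈⟨ -‿+-comm _ _ ⟨
    - (suc m · 1#) - (suc n · 1#)   ∎

  signed : Sign → Carrier → Carrier
  signed Sign.+ x = x
  signed Sign.- x = - x

  ◃-homo : ∀ s n → ⟦ s ◃ n ⟧ℤ ≈ signed s (n · 1#)
  ◃-homo Sign.+ zero    = refl
  ◃-homo Sign.- zero    = sym -0#≈0#
  ◃-homo Sign.+ (suc n) = refl
  ◃-homo Sign.- (suc n) = refl

  ⟦⟧ℤ-sign-abs : ∀ i → ⟦ i ⟧ℤ ≈ signed (sign i) (∣ i ∣ · 1#)
  ⟦⟧ℤ-sign-abs (+ n)    = refl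
  ⟦⟧ℤ-sign-abs -[1+ n ] = refl

  signed-cong : ∀ s {x y} → x ≈ y → signed s x ≈ signed s y
  signed-cong Sign.+ x≈y = x≈y
  signed-cong Sign.- x≈y = -‿cong x≈y

  signed-* : ∀ s t x y → signed (s Sign.* t) (x * y) ≈ signed s x * signed t y
  signed-* Sign.+ Sign.+ x y = refl
  signed-* Sign.+ Sign.- x y = -‿distribʳ-* x y
  signed-* Sign.- Sign.+ x y = -‿distribˡ-* x y
  signed-* Sign.- Sign.- x y = begin
    x * y         ≈⟨ -‿involutive _ ⟨
    - - (x * y)   ≈⟨ -‿cong (-‿distribˡ-* x y) ⟩
    - (- x * y)   ≈⟨ -‿distribʳ-* (- x) y ⟩
    - x * - y     ∎

  *-homo : ∀ i j → ⟦ i ℤ.* j ⟧ℤ ≈ ⟦ i ⟧ℤ * ⟦ j ⟧ℤ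
  *-homo i j = begin
    ⟦ i ℤ.* j ⟧ℤ
      ≈⟨ ◃-homo s (∣ i ∣ ℕ.* ∣ j ∣) ⟩
    signed s ((∣ i ∣ ℕ.* ∣ j ∣) · 1#)
      ≈⟨ signed-cong s (×1-homo-* ∣ i ∣ ∣ j ∣) ⟩
    signed s (∣ i ∣ · 1# * ∣ j ∣ · 1#)
      ≈⟨ signed-* (sign i) (sign j) _ _ ⟩
    signed (sign i) (∣ i ∣ · 1#) * signed (sign j) (∣ j ∣ · 1#)
      ≈⟨ *-cong (⟦⟧ℤ-sign-abs i) (⟦⟧ℤ-sign-abs j) ⟨
    ⟦ i ⟧ℤ * ⟦ j ⟧ℤ
      ∎
    where s = sign i Sign.* sign j

  -‿homo : ∀ i → ⟦ ℤ.- i ⟧ℤ ≈ - ⟦ i ⟧ℤ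
  -‿homo -[1+ n ] = sym (-‿involutive _)
  -‿homo +0       = sym -0#≈0#
  -‿homo +[1+ n ] = refl

  morphism : ℤ.+-*-rawRing ACR.-Raw-AlmostCommutative⟶ ACR.fromCommutativeRing R
  morphism = record
    { ⟦_⟧ = ⟦_⟧ℤ ; +-homo = +-homo ; *-homo = *-homo ; -‿homo = -‿homo
    ; 0-homo = refl ; 1-homo = refl }

  ⟦⟧ℤ-≟ : ∀ i j → Maybe (⟦ i ⟧ℤ ≈ ⟦ j ⟧ℤ)
  ⟦⟧ℤ-≟ i j with i ℤ.≟ j
  ... | yes ≡.refl = just refl
  ... | no _       = nothing

  open import Algebra.Solver.Ring ℤ.+-*-rawRing (ACR.fromCommutativeRing R) morphism ⟦⟧ℤ-≟ public

module _ {a ℓ} (F : Field a ℓ) where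
  open Field F hiding (zero)
  open IntegerCoefficientSolver commutativeRing using (solve; _:=_; con; _:+_; _:*_; _:-_; :-_)
  open import Algebra.Properties.Ring ring
    using (-‿involutive; -0#≈0#; x∙y⁻¹≈ε⇒x≈y; x[y-z]≈xy-xz; +-inverseˡ-unique; +-inverseʳ-unique)
  open import Algebra.Properties.CommutativeSemigroup *-commutativeSemigroup using (x∙yz≈y∙xz)
  open import Relation.Binary.Reasoning.Setoid setoid

  two four : Carrier
  two  = 1# + 1#
  four = two * two

  x*y≈0⇒y≈0 : ∀ {x y} → ¬ x ≈ 0# → x * y ≈ 0# → y ≈ 0#
  x*y≈0⇒y≈0 {x} {y} x≉0 xy≈0 with inverse x x≉0
  ... | x⁻¹ , xx⁻¹≈1 = begin
    y              ≈⟨ *-identityˡ y ⟨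
    1# * y         ≈⟨ *-congʳ (trans (sym xx⁻¹≈1) (*-comm x x⁻¹)) ⟩
    (x⁻¹ * x) * y  ≈⟨ *-assoc x⁻¹ x y ⟩
    x⁻¹ * (x * y)  ≈⟨ *-congˡ xy≈0 ⟩
    x⁻¹ * 0#       ≈⟨ zeroʳ x⁻¹ ⟩
    0#             ∎

  *-cancelˡ-≉0 : ∀ {x y z} → ¬ x ≈ 0# → x * y ≈ x * z → y ≈ z
  *-cancelˡ-≉0 {x} {y} {z} x≉0 xy≈xz = x∙y⁻¹≈ε⇒x≈y y z (x*y≈0⇒y≈0 x≉0 (begin
    x * (y - z)     ≈⟨ x[y-z]≈xy-xz x y z ⟩
    x * y - x * z   ≈⟨ +-congʳ xy≈xz ⟩
    x * z - x * z   ≈⟨ -‿inverseʳ (x * z) ⟩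
    0#              ∎))

  pow-cong : ∀ k {x y} → x ≈ y → pow F x k ≈ pow F y k
  pow-cong zero    x≈y = refl
  pow-cong (suc k) x≈y = *-cong x≈y (pow-cong k x≈y)

  discriminant : Carrier → Carrier → Carrier
  discriminant t n = t * t - four * n

  discriminant-cong : ∀ {t t′ n n′} → t ≈ t′ → n ≈ n′ → discriminant t n ≈ discriminant t′ n′
  discriminant-cong t≈t′ n≈n′ = +-cong (*-cong t≈t′ t≈t′) (-‿cong (*-congˡ n≈n′))

  discriminant-neg : ∀ t n → discriminant (- t) n ≈ discriminant t n
  discriminant-neg =
    solve 2 (λ t n → :- t :* :- t :- con (+ 2) :* con (+ 2) :* n := t :* t :- con (+ 2) :* con (+ 2) :* n) refl

  dickson₂ : ℕ → Carrier → Carrier → Carrier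
  dickson₂ zero          t n = 1#
  dickson₂ (suc zero)    t n = t
  dickson₂ (suc (suc k)) t n = t * dickson₂ (suc k) t n - n * dickson₂ k t n

  Recurrent : Carrier → Carrier → (ℕ → Carrier) → Set ℓ
  Recurrent t n s = ∀ k → s (suc (suc k)) ≈ t * s (suc k) - n * s k

  recurrent-unique : ∀ {t n s s′} → Recurrent t n s → Recurrent t n s′ →
                     s 0 ≈ s′ 0 → s 1 ≈ s′ 1 → ∀ k → s k ≈ s′ k
  recurrent-unique {t} {n} {s} {s′} rec rec′ s₀≈ s₁≈ k = proj₁ (agree k)
    where
    agree : ∀ k → s k ≈ s′ k × s (suc k) ≈ s′ (suc k)
    agree zero    = s₀≈ , s₁≈
    agree (suc k) with agree k
    ... | sₖ≈ , sₖ₊₁≈ = sₖ₊₁≈ , (begin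
      s (suc (suc k))             ≈⟨ rec k ⟩
      t * s (suc k) - n * s k     ≈⟨ +-cong (*-congˡ sₖ₊₁≈) (-‿cong (*-congˡ sₖ≈)) ⟩
      t * s′ (suc k) - n * s′ k   ≈⟨ rec′ k ⟨
      s′ (suc (suc k))            ∎)

  recurrent-cong : ∀ {t t′ n n′ s} → t ≈ t′ → n ≈ n′ → Recurrent t′ n′ s → Recurrent t n s
  recurrent-cong t≈t′ n≈n′ rec k =
    trans (rec k) (+-cong (*-congʳ (sym t≈t′)) (-‿cong (*-congʳ (sym n≈n′))))

  recurrent-*ˡ : ∀ {t n s} w → Recurrent t n s → Recurrent t n (λ k → w * s k)
  recurrent-*ˡ {t} {n} {s} w rec k = begin
    w * s (suc (suc k))
      ≈⟨ *-congˡ (rec k) ⟩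
    w * (t * s (suc k) - n * s k)
      ≈⟨ solve 5 (λ w t n p q → w :* (t :* p :- n :* q) := t :* (w :* p) :- n :* (w :* q)) refl w t n _ _ ⟩
    t * (w * s (suc k)) - n * (w * s k)
      ∎

  dickson-recurrent : ∀ t n → Recurrent t n (λ k → dickson F k t n)
  dickson-recurrent t n zero    = +-congˡ (-‿cong (*-comm two n))
  dickson-recurrent t n (suc k) = refl

  dickson₂-recurrent : ∀ t n → Recurrent t n (λ k → dickson₂ k t n)
  dickson₂-recurrent t n k = refl

  dickson-cong : ∀ k {t t′ n n′} → t ≈ t′ → n ≈ n′ → dickson F k t n ≈ dickson F k t′ n′
  dickson-cong k {t} {t′} {n} {n′} t≈t′ n≈n′ = recurrent-unique (dickson-recurrent t n)
    (recurrent-cong t≈t′ n≈n′ (dickson-recurrent t′ n′)) refl t≈t′ k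

  dickson₂-cong : ∀ k {t t′ n n′} → t ≈ t′ → n ≈ n′ → dickson₂ k t n ≈ dickson₂ k t′ n′
  dickson₂-cong k {t} {t′} {n} {n′} t≈t′ n≈n′ = recurrent-unique (dickson₂-recurrent t n)
    (recurrent-cong t≈t′ n≈n′ (dickson₂-recurrent t′ n′)) refl t≈t′ k

  module _ (Δ : Carrier) where
    open Ext F Δ

    re im trace norm : E → Carrier
    re = proj₁
    im = proj₂
    trace x = two * re x
    norm (u , v) = u * u - Δ * (v * v)

    _·E_ : Carrier → E → E
    a ·E (u , v) = (a * u , a * v)

    _-E_ : E → E → E
    (u , v) -E (u′ , v′) = (u - u′ , v - v′)

    cayley-hamilton : ∀ γ x → (γ *E (γ *E x)) ≈E ((trace γ ·E (γ *E x)) -E (norm γ ·E x))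
    cayley-hamilton (g , y) (p , q) =
      solve 5 (λ g y d p q → g :* (g :* p :+ d :* (y :* q)) :+ d :* (y :* (g :* q :+ y :* p))
                          := con (+ 2) :* g :* (g :* p :+ d :* (y :* q)) :- (g :* g :- d :* (y :* y)) :* p)
              refl g y Δ p q ,
      solve 5 (λ g y d p q → g :* (g :* q :+ y :* p) :+ y :* (g :* p :+ d :* (y :* q))
                          := con (+ 2) :* g :* (g :* q :+ y :* p) :- (g :* g :- d :* (y :* y)) :* q)
              refl g y Δ p q

    *E-identityʳ : ∀ x → (x *E embed 1#) ≈E x
    *E-identityʳ (u , v) =
      solve 3 (λ u v d → u :* con (+ 1) :+ d :* (v :* con (+ 0)) := u) refl u v Δ ,
      solve 2 (λ u v → u :* con (+ 0) :+ v :* con (+ 1) := v) refl u v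

    norm-cong : ∀ {x y} → x ≈E y → norm x ≈ norm y
    norm-cong (u≈ , v≈) = +-cong (*-cong u≈ u≈) (-‿cong (*-congˡ (*-cong v≈ v≈)))

    norm-*E : ∀ x y → norm (x *E y) ≈ norm x * norm y
    norm-*E (p , q) (r , s) =
      solve 5 (λ d p q r s →
                 (p :* r :+ d :* (q :* s)) :* (p :* r :+ d :* (q :* s))
                 :- d :* ((p :* s :+ q :* r) :* (p :* s :+ q :* r))
              := (p :* p :- d :* (q :* q)) :* (r :* r :- d :* (s :* s)))
            refl Δ p q r s

    norm-powE : ∀ γ k → norm (powE γ k) ≈ pow F (norm γ) k
    norm-powE γ zero    =
      solve 1 (λ d → con (+ 1) :* con (+ 1) :- d :* (con (+ 0) :* con (+ 0)) := con (+ 1)) refl Δ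
    norm-powE γ (suc k) = trans (norm-*E γ (powE γ k)) (*-congˡ (norm-powE γ k))

    trace-powE : ∀ γ k → trace (powE γ k) ≈ dickson F k (trace γ) (norm γ)
    trace-powE γ = recurrent-unique
      (recurrent-*ˡ two (λ k → proj₁ (cayley-hamilton γ (powE γ k))))
      (dickson-recurrent (trace γ) (norm γ))
      (*-identityʳ two) (*-congˡ (proj₁ (*E-identityʳ γ)))

    im-powE : ∀ γ k → im (powE γ (suc k)) ≈ im γ * dickson₂ k (trace γ) (norm γ)
    im-powE (g , y) = recurrent-unique
      (λ k → proj₂ (cayley-hamilton (g , y) (powE (g , y) (suc k))))
      (recurrent-*ˡ y (dickson₂-recurrent (trace (g , y)) (norm (g , y))))
      (trans (proj₂ (*E-identityʳ (g , y))) (sym (*-identityʳ y)))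
      (solve 3 (λ g y d → g :* (g :* con (+ 0) :+ y :* con (+ 1))
                          :+ y :* (g :* con (+ 1) :+ d :* (y :* con (+ 0)))
                       := y :* (con (+ 2) :* g)) refl g y Δ)

    discriminant-trace-norm : ∀ x → discriminant (trace x) (norm x) ≈ four * Δ * (im x * im x)
    discriminant-trace-norm (u , v) =
      solve 3 (λ u v d → con (+ 2) :* u :* (con (+ 2) :* u) :- con (+ 2) :* con (+ 2) :* (u :* u :- d :* (v :* v))
                       := con (+ 2) :* con (+ 2) :* d :* (v :* v)) refl u v Δ

    dickson-discriminant-powE : ∀ γ k →
      let t = trace γ; n = norm γ; e = dickson₂ k t n in
      discriminant (dickson F (suc k) t n) (pow F n (suc k)) ≈ discriminant t n * (e * e)
    dickson-discriminant-powE γ k = begin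
      discriminant (dickson F (suc k) t n) (pow F n (suc k))
        ≈⟨ discriminant-cong (trace-powE γ (suc k)) (norm-powE γ (suc k)) ⟨
      discriminant (trace γᵏ⁺¹) (norm γᵏ⁺¹)
        ≈⟨ discriminant-trace-norm γᵏ⁺¹ ⟩
      four * Δ * (im γᵏ⁺¹ * im γᵏ⁺¹)
        ≈⟨ *-congˡ (*-cong (im-powE γ k) (im-powE γ k)) ⟩
      four * Δ * ((im γ * e) * (im γ * e))
        ≈⟨ solve 3 (λ a y e → a :* ((y :* e) :* (y :* e)) := a :* (y :* y) :* (e :* e)) refl _ (im γ) e ⟩
      four * Δ * (im γ * im γ) * (e * e)
        ≈⟨ *-congʳ (discriminant-trace-norm γ) ⟨
      discriminant t n * (e * e)
        ∎
      where
      t n e : Carrier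
      t = trace γ
      n = norm γ
      e = dickson₂ k t n
      γᵏ⁺¹ : E
      γᵏ⁺¹ = powE γ (suc k)

  module _ (two≉0 : ¬ two ≈ 0#) where

    ½ : Carrier
    ½ = proj₁ (inverse two two≉0)

    two*½≈1 : two * ½ ≈ 1#
    two*½≈1 = proj₂ (inverse two two≉0)

    two*[x*½]≈x : ∀ x → two * (x * ½) ≈ x
    two*[x*½]≈x x = begin
      two * (x * ½)  ≈⟨ solve 2 (λ x h → con (+ 2) :* (x :* h) := x :* (con (+ 2) :* h)) refl x ½ ⟩
      x * (two * ½)  ≈⟨ *-congˡ two*½≈1 ⟩
      x * 1#         ≈⟨ *-identityʳ x ⟩
      x              ∎

    four*x≈1⇒x≈½*½ : ∀ {x} → four * x ≈ 1# → x ≈ ½ * ½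
    four*x≈1⇒x≈½*½ {x} four*x≈1 = begin
      x                              ≈⟨ solve 1 (λ x → x := x :* (con (+ 1) :* con (+ 1))) refl x ⟩
      x * (1# * 1#)                  ≈⟨ *-congˡ (*-cong two*½≈1 two*½≈1) ⟨
      x * ((two * ½) * (two * ½))    ≈⟨ solve 2 (λ x h → x :* ((con (+ 2) :* h) :* (con (+ 2) :* h))
                                                   := h :* h :* (con (+ 2) :* con (+ 2) :* x)) refl x ½ ⟩
      ½ * ½ * (four * x)             ≈⟨ *-congˡ four*x≈1 ⟩
      ½ * ½ * 1#                     ≈⟨ *-identityʳ (½ * ½) ⟩
      ½ * ½                          ∎

    -- The left-hand side is the norm of t/2 + √(t² - 4n)/2.
    norm-half : ∀ t n → (t * ½) * (t * ½) - discriminant t n * (½ * ½) ≈ n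
    norm-half t n = begin
      (t * ½) * (t * ½) - discriminant t n * (½ * ½)
        ≈⟨ solve 3 (λ t n h → t :* h :* (t :* h) :- (t :* t :- con (+ 2) :* con (+ 2) :* n) :* (h :* h)
                            := n :* ((con (+ 2) :* h) :* (con (+ 2) :* h))) refl t n ½ ⟩
      n * ((two * ½) * (two * ½))  ≈⟨ *-congˡ (*-cong two*½≈1 two*½≈1) ⟩
      n * (1# * 1#)                ≈⟨ solve 1 (λ n → n :* (con (+ 1) :* con (+ 1)) := n) refl n ⟩
      n                            ∎

    dickson-discriminant : ∀ k t n → let e = dickson₂ k t n in
      discriminant (dickson F (suc k) t n) (pow F n (suc k)) ≈ discriminant t n * (e * e)
    dickson-discriminant k t n = begin
      discriminant (dickson F (suc k) t n) (pow F n (suc k))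
        ≈⟨ discriminant-cong (dickson-cong (suc k) t′≈t n′≈n) (pow-cong (suc k) n′≈n) ⟨
      discriminant (dickson F (suc k) t′ n′) (pow F n′ (suc k))
        ≈⟨ dickson-discriminant-powE (discriminant t n) γ k ⟩
      discriminant t′ n′ * (dickson₂ k t′ n′ * dickson₂ k t′ n′)
        ≈⟨ *-cong (discriminant-cong t′≈t n′≈n) (*-cong e′≈e e′≈e) ⟩
      discriminant t n * (dickson₂ k t n * dickson₂ k t n)
        ∎
      where
      γ : Ext.E F (discriminant t n)
      γ = (t * ½ , ½)
      t′ n′ : Carrier
      t′ = trace (discriminant t n) γ
      n′ = norm (discriminant t n) γ
      t′≈t : t′ ≈ t
      t′≈t = two*[x*½]≈x t
      n′≈n : n′ ≈ n
      n′≈n = norm-half t n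
      e′≈e : dickson₂ k t′ n′ ≈ dickson₂ k t n
      e′≈e = dickson₂-cong k t′≈t n′≈n

    module _ (Δ : Carrier) where
      open Ext F Δ

      trace-im-injective : ∀ {x y} → trace Δ x ≈ trace Δ y → im Δ x ≈ im Δ y → x ≈E y
      trace-im-injective tx≈ty ix≈iy = *-cancelˡ-≉0 two≉0 tx≈ty , ix≈iy

      module ElementWithTraceNorm {t n e v : Carrier} (e≉0 : ¬ e ≈ 0#)
               (Δ≈ : Δ ≈ discriminant t n * (e * e)) (four*v*v≈1 : four * (v * v) ≈ 1#) where

        e⁻¹ : Carrier
        e⁻¹ = proj₁ (inverse e e≉0)

        e*e⁻¹≈1 : e * e⁻¹ ≈ 1#
        e*e⁻¹≈1 = proj₂ (inverse e e≉0)

        γ : E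
        γ = (t * ½ , v * e⁻¹)

        trace-γ : trace Δ γ ≈ t
        trace-γ = two*[x*½]≈x t

        norm-γ : norm Δ γ ≈ n
        norm-γ = trans (+-congˡ (-‿cong Δ*[ve⁻¹]²≈)) (norm-half t n)
          where
          Δ*[ve⁻¹]²≈ : Δ * ((v * e⁻¹) * (v * e⁻¹)) ≈ discriminant t n * (½ * ½)
          Δ*[ve⁻¹]²≈ = begin
            Δ * ((v * e⁻¹) * (v * e⁻¹))
              ≈⟨ *-congʳ Δ≈ ⟩
            discriminant t n * (e * e) * ((v * e⁻¹) * (v * e⁻¹))
              ≈⟨ solve 4 (λ a e f v → a :* (e :* e) :* ((v :* f) :* (v :* f))
                                   := a :* (v :* v) :* ((e :* f) :* (e :* f))) refl _ e e⁻¹ v ⟩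
            discriminant t n * (v * v) * ((e * e⁻¹) * (e * e⁻¹))
              ≈⟨ *-cong (*-congˡ (four*x≈1⇒x≈½*½ four*v*v≈1)) (*-cong e*e⁻¹≈1 e*e⁻¹≈1) ⟩
            discriminant t n * (½ * ½) * (1# * 1#)
              ≈⟨ solve 1 (λ a → a :* (con (+ 1) :* con (+ 1)) := a) refl _ ⟩
            discriminant t n * (½ * ½)
              ∎

        im-γ*e : im Δ γ * e ≈ v
        im-γ*e = begin
          v * e⁻¹ * e    ≈⟨ solve 3 (λ v e f → v :* f :* e := v :* (e :* f)) refl v e e⁻¹ ⟩
          v * (e * e⁻¹)  ≈⟨ *-congˡ e*e⁻¹≈1 ⟩
          v * 1#         ≈⟨ *-identityʳ v ⟩
          v              ∎

  module QuadraticRoot (b c : Carrier) where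

    Δ : Carrier
    Δ = discriminant b c

    open Ext F Δ

    f : E → E
    f x = ((x *E x) +E (embed b *E x)) +E embed c

    DicksonForm : ℕ → Set (a ⊔ ℓ)
    DicksonForm m = Σ Carrier λ n → Σ Carrier λ t → (c ≈ pow F n m) × (b ≈ - dickson F m t n)

    module _ (α : E) (root : f α ≈E embed 0#) (α∉F : ¬ InF α) where

      u v : Carrier
      u = re Δ α
      v = im Δ α

      trace+b≈0 : trace Δ α + b ≈ 0#
      trace+b≈0 = x*y≈0⇒y≈0 α∉F (trans
        (solve 3 (λ u v b → v :* (con (+ 2) :* u :+ b)
                          := u :* v :+ v :* u :+ (b :* v :+ con (+ 0) :* u) :+ con (+ 0)) refl u v b)
        (proj₂ root))

      trace≈-b : trace Δ α ≈ - b
      trace≈-b = +-inverseˡ-unique _ _ trace+b≈0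

      b≈-trace : b ≈ - trace Δ α
      b≈-trace = +-inverseʳ-unique _ _ trace+b≈0

      norm≈c : norm Δ α ≈ c
      norm≈c = sym (x∙y⁻¹≈ε⇒x≈y c (norm Δ α) (begin
        c - norm Δ α
          ≈⟨ solve 5 (λ u v b c d → c :- (u :* u :- d :* (v :* v))
                                  := u :* u :+ d :* (v :* v) :+ (b :* u :+ d :* (con (+ 0) :* v)) :+ c
                                     :- u :* (con (+ 2) :* u :+ b)) refl u v b c Δ ⟩
        re Δ (f α) - u * (trace Δ α + b)
          ≈⟨ +-cong (proj₁ root) (-‿cong (*-congˡ trace+b≈0)) ⟩
        0# - u * 0#
          ≈⟨ solve 1 (λ u → con (+ 0) :- u :* con (+ 0) := con (+ 0)) refl u ⟩
        0# ∎))

      power⇒dickson : ∀ m → (Σ E λ γ → powE γ m ≈E α) → DicksonForm m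
      power⇒dickson m (γ , γᵐ≈α) = norm Δ γ , trace Δ γ , c≈ , b≈
        where
        c≈ : c ≈ pow F (norm Δ γ) m
        c≈ = begin
          c                   ≈⟨ norm≈c ⟨
          norm Δ α            ≈⟨ norm-cong Δ γᵐ≈α ⟨
          norm Δ (powE γ m)   ≈⟨ norm-powE Δ γ m ⟩
          pow F (norm Δ γ) m  ∎
        b≈ : b ≈ - dickson F m (trace Δ γ) (norm Δ γ)
        b≈ = begin
          b                                      ≈⟨ b≈-trace ⟩
          - trace Δ α                            ≈⟨ -‿cong (*-congˡ (proj₁ γᵐ≈α)) ⟨
          - trace Δ (powE γ m)                   ≈⟨ -‿cong (trace-powE Δ γ m) ⟩
          - dickson F m (trace Δ γ) (norm Δ γ)   ∎

      module _ (irreducible : IrreducibleQuad F b c) where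

        Δ≉0 : ¬ Δ ≈ 0#
        Δ≉0 Δ≈0 = irreducible (- u , - u , -u-u≈b , -u*-u≈c)
          where
          -u-u≈b : - u + - u ≈ b
          -u-u≈b = trans (solve 1 (λ u → :- u :+ :- u := :- (con (+ 2) :* u)) refl u) (sym b≈-trace)
          -u*-u≈c : - u * - u ≈ c
          -u*-u≈c = begin
            - u * - u             ≈⟨ solve 2 (λ u v → :- u :* :- u := u :* u :- con (+ 0) :* (v :* v)) refl u v ⟩
            u * u - 0# * (v * v)  ≈⟨ +-congˡ (-‿cong (*-congʳ Δ≈0)) ⟨
            norm Δ α              ≈⟨ norm≈c ⟩
            c                     ∎

        two≉0 : ¬ two ≈ 0#
        two≉0 two≈0 = Δ≉0 (begin
          b * b - two * two * c
            ≈⟨ +-cong (*-cong b≈0 b≈0) (-‿cong (*-congʳ (*-cong two≈0 two≈0))) ⟩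
          0# * 0# - 0# * 0# * c
            ≈⟨ solve 1 (λ c → con (+ 0) :* con (+ 0) :- con (+ 0) :* con (+ 0) :* c := con (+ 0)) refl c ⟩
          0#
            ∎)
          where
          b≈0 : b ≈ 0#
          b≈0 = trans b≈-trace (trans (-‿cong (trans (*-congʳ two≈0) (zeroˡ u))) -0#≈0#)

        four*v*v≈1 : four * (v * v) ≈ 1#
        four*v*v≈1 = *-cancelˡ-≉0 Δ≉0 (begin
          Δ * (four * (v * v))                 ≈⟨ x∙yz≈y∙xz Δ four (v * v) ⟩
          four * (Δ * (v * v))                 ≈⟨ *-assoc four Δ (v * v) ⟨
          four * Δ * (v * v)                   ≈⟨ discriminant-trace-norm Δ α ⟨
          discriminant (trace Δ α) (norm Δ α)  ≈⟨ discriminant-cong trace≈-b norm≈c ⟩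
          discriminant (- b) c                 ≈⟨ discriminant-neg b c ⟩
          Δ                                    ≈⟨ *-identityʳ Δ ⟨
          Δ * 1#                               ∎)

        dickson⇒power : ∀ k → DicksonForm (suc k) → Σ E λ γ → powE γ (suc k) ≈E α
        dickson⇒power k (n , t , c≈nᵏ⁺¹ , b≈-D) = γ , trace-im-injective two≉0 Δ trace≈ im≈
          where
          D e : Carrier
          D = dickson F (suc k) t n
          e = dickson₂ k t n

          Δ≈ : Δ ≈ discriminant t n * (e * e)
          Δ≈ = begin
            discriminant b c                      ≈⟨ discriminant-cong b≈-D c≈nᵏ⁺¹ ⟩
            discriminant (- D) (pow F n (suc k))  ≈⟨ discriminant-neg D _ ⟩
            discriminant D (pow F n (suc k))      ≈⟨ dickson-discriminant two≉0 k t n ⟩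
            discriminant t n * (e * e)            ∎

          e≉0 : ¬ e ≈ 0#
          e≉0 e≈0 = Δ≉0 (begin
            Δ                           ≈⟨ Δ≈ ⟩
            discriminant t n * (e * e)  ≈⟨ *-congˡ (trans (*-congʳ e≈0) (zeroˡ e)) ⟩
            discriminant t n * 0#       ≈⟨ zeroʳ _ ⟩
            0#                          ∎)

          open ElementWithTraceNorm two≉0 Δ e≉0 Δ≈ four*v*v≈1

          trace≈ : trace Δ (powE γ (suc k)) ≈ trace Δ α
          trace≈ = begin
            trace Δ (powE γ (suc k))                     ≈⟨ trace-powE Δ γ (suc k) ⟩
            dickson F (suc k) (trace Δ γ) (norm Δ γ)     ≈⟨ dickson-cong (suc k) trace-γ norm-γ ⟩
            D                                            ≈⟨ -‿involutive D ⟨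
            - - D                                        ≈⟨ -‿cong b≈-D ⟨
            - b                                          ≈⟨ trace≈-b ⟨
            trace Δ α                                    ∎

          im≈ : im Δ (powE γ (suc k)) ≈ v
          im≈ = begin
            im Δ (powE γ (suc k))                      ≈⟨ im-powE Δ γ k ⟩
            im Δ γ * dickson₂ k (trace Δ γ) (norm Δ γ) ≈⟨ *-congˡ (dickson₂-cong k trace-γ norm-γ) ⟩
            im Δ γ * e                                 ≈⟨ im-γ*e ⟩
            v                                          ∎

theorem3p1 : {ℓc ℓ : Level} (F : Field ℓc ℓ) (b c : Field.Carrier F) →
    let open Field F in
    let Δ = (b * b) - ((1# + 1#) * (1# + 1#) * c) in
    let open Ext F Δ in
    IrreducibleQuad F b c →
    (α : E) →
    (((α *E α) +E (embed b *E α)) +E embed c) ≈E embed 0# →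
    ¬ InF α →
    (m : ℕ) → 1 ≤ m →
    (Σ E λ γ → powE γ m ≈E α)
      ⇔ (Σ Carrier λ n → Σ Carrier λ t → (c ≈ pow F n m) × (b ≈ (- dickson F m t n)))
theorem3p1 F b c irreducible α root α∉F (suc k) _ =
  mk⇔ (power⇒dickson α root α∉F (suc k)) (dickson⇒power α root α∉F irreducible k)
  where open QuadraticRoot F b c
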